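{- Let $\sigma$ be a permutation of $[n]$ and let $X=(\psi_1,\dots,\psi_T)$ be a type schedule with $\psi_t\in\{\mathtt q,\mathtt s\}^{m_t}$. Then $X$ sorts $\sigma$ if and only if the change profile $\Delta(\sigma)$ is accepted by the chain automaton $\Pi(\hat\psi)$, where $\hat\psi=\psi_1\backslash\psi_2\backslash\cdots\backslash\psi_T$ is the virtual type sequence of $X$.
   Context: Pile shuffle model: a deck is a permutation $\sigma$ of $[n]$ ($\sigma(s)$ = position of card $s$); sorted = identity. With $\Sigma=\{\mathtt q,\mathtt s\}$, one round with types $\psi\in\Sigma^m$ and pile assignment $p:[n]\to[m]$ yields $\tau$ with, for $s\neq t$: $\tau(s)<\tau(t)$ iff $p(s)<p(t)$, or $p(s)=p(t)$, $\psi(p(s))=\mathtt q$, $\sigma(s)<\sigma(t)$, or $p(s)=p(t)$, $\psi(p(s))=\mathtt s$, $\sigma(s)>\sigma(t)$. A schedule $X=(\psi_1,\dots,\psi_T)$ sorts $\sigma$ if there exist $p_t:[n]\to[m_t]$ such that applying the rounds $(\psi_t,p_t)$ successively (each output is the next input) ends with the identity. Change profile $\Delta(\sigma)\in\{a,d\}^{n-1}$: letter $s$ is $a$ if $\sigma(s+1)>\sigma(s)$, else $d$. Chain automaton: for $\psi\in\Sigma^N$ indexed $\psi(0),\dots,\psi(N-1)$, $\Pi(\psi)$ is the DFA over $\{a,d\}$ with states $\{0,\dots,N\}$, start $0$, accepting $\{0,\dots,N-1\}$, transition from $k<N$ on $c$ to $k+[\psi(k)=\mathtt q, c=d]+[\psi(k)=\mathtt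 s, c=a]$, and $N$ absorbing. Virtual types: index each $\psi_t$ as $\psi_t(0),\dots,\psi_t(m_t-1)$; let $\chi_t(r)=1$ if $\psi_t(r)=\mathtt s$ and $0$ otherwise; let $M_t=\prod_{t\le t'\le T}m_{t'}$ (so $M_{T+1}=1$); set $\hat\chi_{T+1}(0)=0$ and for $t=T,\dots,1$ define $\hat\chi_t$ on $\{0,\dots,M_t-1\}$ by $\hat\chi_t(r+m_tq)=\chi_t(\mathrm{rev}_{m_t}^{\hat\chi_{t+1}(q)}(r))\oplus\hat\chi_{t+1}(q)$ for $0\le r<m_t$, $0\le q<M_{t+1}$, where $\mathrm{rev}_m(y)=m-1-y$, $\mathrm{rev}^0$ is the identity, and $\oplus$ is addition mod 2. Then $\hat\psi\in\Sigma^{M_1}$ is given by $\hat\psi(j)=\mathtt s$ iff $\hat\chi_1(j)=1$. -}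

module Defs where

open import Data.Nat as ℕ using (ℕ; zero; suc; _+_; _*_; _<?_)
open import Data.Fin as Fin using (Fin; fromℕ<; inject₁; opposite; remQuot)
open import Data.Fin.Permutation using (Permutation′; _⟨$⟩ʳ_)
open import Data.Vec using (Vec; lookup)
open import Data.List as List using (List; []; _∷_; foldl)
open import Data.Bool using (Bool; true; false; if_then_else_; _xor_)
open import Data.Product using (Σ; _,_; _×_; proj₁; proj₂)
open import Data.Sum using (_⊎_)
open import Function.Bundles using (_⇔_)
open import Relation.Binary.PropositionalEquality using (_≡_; _≢_)
open import Relation.Nullary using (yes; no)

data Ty : Set where
  q s : Ty

data Letter : Set where
  a d : Letter

Schedule : Set
Schedule = List (Σ ℕ (λ m → Vec Ty m))

Round : ∀ {n m} → Permutation′ n → Vec Ty m → (Fin n → Fin m) → Permutation′ n → Set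
Round {n} σ ψ p τ =
  (c c′ : Fin n) → c ≢ c′ →
    ((τ ⟨$⟩ʳ c) Fin.< (τ ⟨$⟩ʳ c′)) ⇔
      ( (p c Fin.< p c′)
      ⊎ (p c ≡ p c′ × lookup ψ (p c) ≡ q × (σ ⟨$⟩ʳ c) Fin.< (σ ⟨$⟩ʳ c′))
      ⊎ (p c ≡ p c′ × lookup ψ (p c) ≡ s × (σ ⟨$⟩ʳ c′) Fin.< (σ ⟨$⟩ʳ c)) )

IsSorted : ∀ {n} → Permutation′ n → Set
IsSorted {n} σ = (c : Fin n) → σ ⟨$⟩ʳ c ≡ c

data Sorts {n : ℕ} : Schedule → Permutation′ n → Set where
  done : ∀ {σ} → IsSorted σ → Sorts [] σ
  step : ∀ {m} {ψ : Vec Ty m} {X σ} (p : Fin n → Fin m) (τ : Permutation′ n) →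
         Round σ ψ p τ → Sorts X τ → Sorts ((m , ψ) ∷ X) σ

-- change profile Δ(σ): letter i (0-based, i < n-1) compares σ(i+1) with σ(i)
changeLetter : ∀ {n} → Fin n → Fin n → Letter
changeLetter x y with Fin.toℕ x <? Fin.toℕ y
... | yes _ = a
... | no _  = d

Δ : ∀ {n} → Permutation′ n → List Letter
Δ {zero} σ = []
Δ {suc k} σ = List.map (λ (i : Fin k) → changeLetter (σ ⟨$⟩ʳ inject₁ i) (σ ⟨$⟩ʳ Fin.suc i))
                       (List.allFin k)

-- chain automaton Π(ψ), ψ ∈ Σ^N, states 0..N, N absorbing
bump : Ty → Letter → ℕ
bump q d = 1
bump s a = 1
bump _ _ = 0

chainStep : ∀ {N} → Vec Ty N → ℕ → Letter → ℕ
chainStep {N} ψ k c with k <? N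
... | yes k<N = k + bump (lookup ψ (fromℕ< k<N)) c
... | no _    = k

chainRun : ∀ {N} → Vec Ty N → List Letter → ℕ
chainRun ψ w = foldl (chainStep ψ) 0 w

Accepts : ∀ {N} → Vec Ty N → List Letter → Set
Accepts {N} ψ w = chainRun ψ w ℕ.< N

M : Schedule → ℕ
M [] = 1
M ((m , _) ∷ X) = M X * m

χ : Ty → Bool
χ q = false
χ s = true

revIf : ∀ {m} → Bool → Fin m → Fin m
revIf true r = opposite r
revIf false r = r

-- index j = r + m_t * q' decomposes as remQuot: Fin (M X * m) → Fin (M X) × Fin m
χ̂ : (X : Schedule) → Fin (M X) → Bool
χ̂ [] _ = false
χ̂ ((m , ψ) ∷ X) j =
  let qr = remQuot {M X} m j
      b  = χ̂ X (proj₁ qr)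
  in χ (lookup ψ (revIf b (proj₂ qr))) xor b

toTy : Bool → Ty
toTy true = s
toTy false = q

ψ̂ : (X : Schedule) → Vec Ty (M X)
ψ̂ X = Data.Vec.tabulate (λ j → toTy (χ̂ X j))

-- A round files card c under the key (pile of c, old position of c, read backwards in an s pile),
-- so the new deck order is a lexicographic order built from the old one. Two successive rounds
-- therefore act as a single round whose piles are the pairs (later pile, earlier pile), the earlier
-- index reversed and the type flipped (xor) under an s pile of the later round: these are exactly
-- the virtual types, so by induction X sorts σ iff a single round with types ψ̂ sorts σ. A single
-- round sorts σ iff consecutive cards go to non-decreasing piles and share a pile only when the
-- change letter agrees with the pile type. The chain automaton computes the greedy such
-- assignment, which is pointwise least, so one exists within the N virtual piles iff Δ σ is
-- accepted.
module Submission where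

open import Defs
open import Data.Nat using (ℕ; _≤_)
open import Data.Fin.Permutation using (Permutation′)
open import Function.Bundles using (_⇔_)

open import Data.Bool using (Bool; true; false; _xor_)
open import Data.Bool.Properties using (xor-identityʳ)
open import Data.Empty using (⊥; ⊥-elim)
open import Data.Fin as Fin
  using (Fin; zero; suc; toℕ; fromℕ; fromℕ<; inject₁; opposite; combine; remQuot; punchOut; _<_)
import Data.Fin.Properties as Fin
open import Data.Fin.Induction using (<-weakInduction; >-weakInduction)
open import Data.Fin.Permutation using (_⟨$⟩ʳ_; permutation)
open import Data.List using (List; []; _∷_; foldl; tabulate)
import Data.List.Properties as List
open import Data.Nat as ℕ using (zero; suc; _+_; _*_; z≤n; s≤s)
import Data.Nat.Properties as ℕ
open import Data.Product as Product using (∃; _×_; _,_; proj₁; proj₂; map₂)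
open import Data.Product.Function.NonDependent.Propositional using (_×-⇔_)
open import Data.Sum using (_⊎_; inj₁; inj₂)
open import Data.Sum.Function.Propositional using (_⊎-⇔_)
open import Data.Vec using (Vec; lookup)
import Data.Vec.Properties as Vec
open import Function using (_∘_; id)
open import Function.Bundles using (mk⇔; Equivalence; Injection)
open import Function.Definitions using (Injective)
import Function.Properties.Equivalence as ⇔
open import Function.Properties.Inverse using (↔⇒↣)
open import Level using (0ℓ) renaming (suc to lsuc)
open import Relation.Binary.Bundles using (Setoid)
open import Relation.Binary.Core using (Rel; _Preserves_⟶_)
open import Relation.Binary.Definitions using (Transitive; Asymmetric; tri<; tri≈; tri>)
open import Relation.Binary.PropositionalEquality
import Relation.Binary.Reasoning.Setoid as SetoidReasoning
open import Relation.Nullary using (Dec; yes; no; contradiction)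

open Equivalence

module ⇔-Reasoning = SetoidReasoning (⇔.⇔-setoid 0ℓ)

private variable
  k m n K N : ℕ
  A A′ A″ B B′ B″ : Set

-- Lexicographic orders

-- b is the type bit χ of a pile: a q pile keeps the old order of two of its cards (A),
-- an s pile reverses it (B).
Oriented : Bool → Set → Set → Set
Oriented false A B = A
Oriented true  A B = B

Lex : Bool → Fin m → Fin m → Set → Set → Set
Lex b i j A B = i < j ⊎ (i ≡ j × Oriented b A B)

Oriented-cong : ∀ b → A ⇔ A′ → B ⇔ B′ → Oriented b A B ⇔ Oriented b A′ B′
Oriented-cong false A⇔A′ _ = A⇔A′
Oriented-cong true  _ B⇔B′ = B⇔B′

Lex-cong : ∀ {b} {i j : Fin m} → A ⇔ A′ → B ⇔ B′ → Lex b i j A B ⇔ Lex b i j A′ B′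
Lex-cong {b = b} A⇔A′ B⇔B′ = ⇔.refl ⊎-⇔ (⇔.refl ×-⇔ Oriented-cong b A⇔A′ B⇔B′)

Lex-cong-≡ : ∀ {b b′} {i i′ j j′ : Fin m} →
             b ≡ b′ → i ≡ i′ → j ≡ j′ → Lex b i j A B ⇔ Lex b′ i′ j′ A B
Lex-cong-≡ refl refl refl = ⇔.refl

Lex-trans : ∀ (β : Fin m → Bool) {i j l} → (A → A′ → A″) → (B′ → B → B″) →
            Lex (β i) i j A B → Lex (β j) j l A′ B′ → Lex (β i) i l A″ B″
Lex-trans β f g (inj₁ i<j)        (inj₁ j<l)        = inj₁ (Fin.<-trans i<j j<l)
Lex-trans β f g (inj₁ i<j)        (inj₂ (refl , _)) = inj₁ i<j
Lex-trans β f g (inj₂ (refl , _)) (inj₁ j<l)        = inj₁ j<l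
Lex-trans β {i} f g (inj₂ (refl , x)) (inj₂ (refl , y)) = inj₂ (refl , zip (β i) x y)
  where
  zip : ∀ b → Oriented b _ _ → Oriented b _ _ → Oriented b _ _
  zip false x y = f x y
  zip true  x y = g y x

Lex-asym : ∀ (β : Fin m → Bool) {i j} → (A → B → ⊥) →
           Lex (β i) i j A B → Lex (β j) j i B A → ⊥
Lex-asym β ¬AB (inj₁ i<j)        (inj₁ j<i)        = Fin.<-asym i<j j<i
Lex-asym β ¬AB (inj₁ i<j)        (inj₂ (refl , _)) = Fin.<-irrefl refl i<j
Lex-asym β ¬AB (inj₂ (refl , _)) (inj₁ j<i)        = Fin.<-irrefl refl j<i
Lex-asym β {i} ¬AB (inj₂ (refl , x)) (inj₂ (_ , y)) = clash (β i) x y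
  where
  clash : ∀ b → Oriented b _ _ → Oriented b _ _ → ⊥
  clash false x y = ¬AB x y
  clash true  x y = ¬AB y x

opposite-< : {i j : Fin n} → i < j → opposite j < opposite i
opposite-< {i = i} {j} i<j rewrite Fin.opposite-prop i | Fin.opposite-prop j =
  ℕ.∸-monoʳ-< (s≤s i<j) (Fin.toℕ<n j)

revIf-involutive : ∀ b (i : Fin n) → revIf b (revIf b i) ≡ i
revIf-involutive true  i = Fin.opposite-involutive i
revIf-involutive false i = refl

revIf-injective : ∀ b {i j : Fin n} → revIf b i ≡ revIf b j → i ≡ j
revIf-injective b {i} {j} e =
  trans (sym (revIf-involutive b i)) (trans (cong (revIf b) e) (revIf-involutive b j))

revIf-< : ∀ b {i j : Fin n} → revIf b i < revIf b j ⇔ Oriented b (i < j) (j < i)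
revIf-< false = ⇔.refl
revIf-< true {i} {j} = mk⇔ reflect opposite-<
  where
  reflect : opposite i < opposite j → j < i
  reflect lt = subst₂ _<_ (Fin.opposite-involutive j) (Fin.opposite-involutive i) (opposite-< lt)

combine-< : ∀ {i j : Fin K} {x y : Fin m} →
            combine i x < combine j y ⇔ (i < j ⊎ (i ≡ j × x < y))
combine-< {K} {m} {i} {j} {x} {y} = mk⇔ reflect preserve
  where
  preserve : i < j ⊎ (i ≡ j × x < y) → combine i x < combine j y
  preserve (inj₁ i<j)          = Fin.combine-monoˡ-< x y i<j
  preserve (inj₂ (refl , x<y)) rewrite Fin.toℕ-combine i x | Fin.toℕ-combine i y =
    ℕ.+-monoʳ-< (m * toℕ i) x<y
  reflect : combine i x < combine j y → i < j ⊎ (i ≡ j × x < y)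
  reflect lt with Fin.<-cmp i j
  ... | tri< i<j _ _ = inj₁ i<j
  ... | tri> _ _ j<i = ⊥-elim (Fin.<-asym lt (Fin.combine-monoˡ-< y x j<i))
  ... | tri≈ _ refl _ rewrite Fin.toℕ-combine i x | Fin.toℕ-combine i y =
    inj₂ (refl , ℕ.+-cancelˡ-< (m * toℕ i) _ _ lt)

-- The virtual pile of a card put into pile r and then into pile i; an s pile i reverses
-- the inner piles.
merge : (Fin K → Bool) → Fin K → Fin m → Fin (K * m)
merge β i r = combine i (revIf (β i) r)

merge-< : ∀ (β : Fin K → Bool) {i j} {x y : Fin m} →
          merge β i x < merge β j y ⇔ Lex (β i) i j (x < y) (y < x)
merge-< β {i} {j} {x} {y} = mk⇔ reflect preserve
  where
  reflect : merge β i x < merge β j y → Lex (β i) i j (x < y) (y < x)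
  reflect lt with to combine-< lt
  ... | inj₁ i<j        = inj₁ i<j
  ... | inj₂ (refl , o) = inj₂ (refl , to (revIf-< (β i)) o)
  preserve : Lex (β i) i j (x < y) (y < x) → merge β i x < merge β j y
  preserve (inj₁ i<j)        = from (combine-< {i = i}) (inj₁ i<j)
  preserve (inj₂ (refl , o)) = from (combine-< {i = i}) (inj₂ (refl , from (revIf-< (β i)) o))

merge-injective : ∀ (β : Fin K → Bool) {i j} {x y : Fin m} →
                  merge β i x ≡ merge β j y → i ≡ j × x ≡ y
merge-injective β {i} {j} e with Fin.combine-injective i _ j _ e
... | refl , e′ = refl , revIf-injective (β i) e′

unmerge : (Fin K → Bool) → Fin (K * m) → Fin K × Fin m
unmerge {K} {m} β j = Product.map id (λ {i} → revIf (β i)) (remQuot {K} m j)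

unmerge-merge : ∀ (β : Fin K → Bool) i (r : Fin m) → unmerge β (merge β i r) ≡ (i , r)
unmerge-merge {K} {m} β i r =
  trans (cong (Product.map id (λ {i} → revIf (β i))) (Fin.remQuot-combine {K} {m} i _))
        (cong (i ,_) (revIf-involutive (β i) r))

merge-unmerge : ∀ (β : Fin K → Bool) (j : Fin (K * m)) →
                merge β (proj₁ (unmerge β j)) (proj₂ (unmerge β j)) ≡ j
merge-unmerge {K} {m} β j =
  trans (cong (combine i) (revIf-involutive (β i) _)) (Fin.combine-remQuot {K} m j)
  where i = proj₁ (remQuot {K} m j)

inject₁<suc : ∀ (i : Fin n) → inject₁ i < suc i
inject₁<suc i = Fin.≤̄⇒inject₁< Fin.≤-refl

increasing⇒≗id : ∀ (f : Fin n → Fin n) → f Preserves _<_ ⟶ _<_ → ∀ c → f c ≡ c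
increasing⇒≗id {suc n} f f-mono c = Fin.≤-antisym (below c) (above c)
  where
  above : ∀ c → c Fin.≤ f c
  above = <-weakInduction (λ c → c Fin.≤ f c) z≤n λ i ih →
    subst (λ x → suc x ≤ toℕ (f (suc i))) (Fin.toℕ-inject₁ i)
          (ℕ.≤-<-trans ih (f-mono (inject₁<suc i)))

  below : ∀ c → f c Fin.≤ c
  below = >-weakInduction (λ c → f c Fin.≤ c) (Fin.≤fromℕ _) λ i ih →
    subst (toℕ (f (inject₁ i)) ≤_) (sym (Fin.toℕ-inject₁ i))
          (ℕ.s≤s⁻¹ (ℕ.<-≤-trans (f-mono (inject₁<suc i)) ih))

adjacent⇒< : ∀ {ℓ} {R : Rel (Fin (suc k)) ℓ} → Transitive R → (∀ i → R (inject₁ i) (suc i)) →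
             ∀ {c c′} → c < c′ → R c c′
adjacent⇒< {R = R} R-trans adjacent {c} {c′} =
  <-weakInduction (λ c′ → c < c′ → R c c′) (λ ()) extend c′
  where
  extend : ∀ i → (c < inject₁ i → R c (inject₁ i)) → c < suc i → R c (suc i)
  extend i ih c<1+i with ℕ.m≤n⇒m<n∨m≡n (ℕ.s≤s⁻¹ c<1+i)
  ... | inj₁ c<i = R-trans (ih (subst (toℕ c ℕ.<_) (sym (Fin.toℕ-inject₁ i)) c<i)) (adjacent i)
  ... | inj₂ c≡i = subst (λ x → R x (suc i)) c-is-i (adjacent i)
    where c-is-i = Fin.toℕ-injective (trans (Fin.toℕ-inject₁ i) (sym c≡i))

indicator : {P : Set} → Dec P → ℕ
indicator (yes _) = 1
indicator (no _)  = 0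

indicator-≤1 : {P : Set} (p : Dec P) → indicator p ≤ 1
indicator-≤1 (yes _) = ℕ.≤-refl
indicator-≤1 (no _)  = z≤n

indicator-mono : {P Q : Set} → (P → Q) → (p : Dec P) (q : Dec Q) → indicator p ≤ indicator q
indicator-mono P⇒Q (yes P) (yes _) = ℕ.≤-refl
indicator-mono P⇒Q (yes P) (no ¬Q) = contradiction (P⇒Q P) ¬Q
indicator-mono P⇒Q (no _)  _       = z≤n

countBelow : (Fin n → ℕ) → ℕ → ℕ
countBelow {zero}  key v = 0
countBelow {suc n} key v = indicator (key zero ℕ.<? v) + countBelow (key ∘ suc) v

countBelow-mono : ∀ (key : Fin n → ℕ) {v v′} → v ≤ v′ → countBelow key v ≤ countBelow key v′
countBelow-mono {zero}  key v≤v′ = z≤n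
countBelow-mono {suc n} key v≤v′ =
  ℕ.+-mono-≤ (indicator-mono (λ k<v → ℕ.<-≤-trans k<v v≤v′) _ _)
             (countBelow-mono (key ∘ suc) v≤v′)

countBelow≤n : ∀ (key : Fin n → ℕ) v → countBelow key v ≤ n
countBelow≤n {zero}  key v = z≤n
countBelow≤n {suc n} key v = ℕ.+-mono-≤ (indicator-≤1 _) (countBelow≤n (key ∘ suc) v)

countBelow<n : ∀ (key : Fin n → ℕ) {v} c → v ≤ key c → countBelow key v ℕ.< n
countBelow<n {suc n} key {v} zero v≤k with key zero ℕ.<? v
... | yes k<v = contradiction v≤k (ℕ.<⇒≱ k<v)
... | no _    = s≤s (countBelow≤n (key ∘ suc) v)
countBelow<n {suc n} key (suc c) v≤k =
  ℕ.+-mono-≤-< (indicator-≤1 _) (countBelow<n (key ∘ suc) c v≤k)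

countBelow-strict : ∀ (key : Fin n → ℕ) {v v′} c → v ≤ key c → key c ℕ.< v′ →
                    countBelow key v ℕ.< countBelow key v′
countBelow-strict {suc n} key {v} {v′} zero v≤k k<v′ with key zero ℕ.<? v | key zero ℕ.<? v′
... | yes k<v | _       = contradiction v≤k (ℕ.<⇒≱ k<v)
... | no _    | no k≮v′ = contradiction k<v′ k≮v′
... | no _    | yes _   = s≤s (countBelow-mono (key ∘ suc) (ℕ.≤-trans v≤k (ℕ.<⇒≤ k<v′)))
countBelow-strict {suc n} key (suc c) v≤k k<v′ =
  ℕ.+-mono-≤-< (indicator-mono (λ k<v → ℕ.<-trans k<v (ℕ.≤-<-trans v≤k k<v′)) _ _)
               (countBelow-strict (key ∘ suc) c v≤k k<v′)

injective⇒surjective : ∀ (f : Fin n → Fin n) → Injective _≡_ _≡_ f → ∀ y → ∃ λ x → f x ≡ y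
injective⇒surjective {suc n} f f-inj y with Fin.any? (λ x → f x Fin.≟ y)
... | yes hit = hit
... | no miss = contradiction (Fin.injective⇒≤ g-inj) ℕ.1+n≰n
  where
  g : Fin (suc n) → Fin n
  g x = punchOut {i = y} (λ y≡fx → miss (x , sym y≡fx))
  g-inj : Injective _≡_ _≡_ g
  g-inj = f-inj ∘ Fin.punchOut-injective {i = y} _ _

rank : ∀ (key : Fin n → ℕ) → Injective _≡_ _≡_ key →
       ∃ λ (τ : Permutation′ n) → ∀ c c′ → τ ⟨$⟩ʳ c < τ ⟨$⟩ʳ c′ ⇔ key c ℕ.< key c′
rank {n} key key-inj =
  permutation position unposition position-unposition unposition-position ,
  λ c c′ → mk⇔ reflect preserve
  where
  position : Fin n → Fin n
  position c = fromℕ< (countBelow<n key c ℕ.≤-refl)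

  toℕ-position : ∀ c → toℕ (position c) ≡ countBelow key (key c)
  toℕ-position c = Fin.toℕ-fromℕ< (countBelow<n key c ℕ.≤-refl)

  preserve : ∀ {c c′} → key c ℕ.< key c′ → position c < position c′
  preserve {c} {c′} lt rewrite toℕ-position c | toℕ-position c′ =
    countBelow-strict key c ℕ.≤-refl lt

  reflect : ∀ {c c′} → position c < position c′ → key c ℕ.< key c′
  reflect {c} {c′} lt with key c ℕ.<? key c′
  ... | yes k<k′ = k<k′
  ... | no  k≮k′ = contradiction (countBelow-mono key (ℕ.≮⇒≥ k≮k′))
                     (ℕ.<⇒≱ (subst₂ ℕ._<_ (toℕ-position c) (toℕ-position c′) lt))

  position-inj : Injective _≡_ _≡_ position
  position-inj {c} {c′} e with ℕ.<-cmp (key c) (key c′)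
  ... | tri< lt _ _ = contradiction e (Fin.<⇒≢ (preserve lt))
  ... | tri≈ _ eq _ = key-inj eq
  ... | tri> _ _ gt = contradiction (sym e) (Fin.<⇒≢ (preserve gt))

  unposition : Fin n → Fin n
  unposition y = proj₁ (injective⇒surjective position position-inj y)

  position-unposition : ∀ y → position (unposition y) ≡ y
  position-unposition y = proj₂ (injective⇒surjective position position-inj y)

  unposition-position : ∀ c → unposition (position c) ≡ c
  unposition-position c = position-inj (position-unposition (position c))

DeckLt : Permutation′ n → Rel (Fin n) 0ℓ
DeckLt σ c c′ = σ ⟨$⟩ʳ c < σ ⟨$⟩ʳ c′

infix 4 _≋_

_≋_ : Rel (Fin n) 0ℓ → Rel (Fin n) 0ℓ → Set
R ≋ R′ = ∀ c c′ → c ≢ c′ → R c c′ ⇔ R′ c c′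

≋-sym : {R R′ : Rel (Fin n) 0ℓ} → R ≋ R′ → R′ ≋ R
≋-sym R≋R′ c c′ c≢c′ = ⇔.sym (R≋R′ c c′ c≢c′)

≋-trans : {R R′ R″ : Rel (Fin n) 0ℓ} → R ≋ R′ → R′ ≋ R″ → R ≋ R″
≋-trans R≋R′ R′≋R″ c c′ c≢c′ = ⇔.trans (R≋R′ c c′ c≢c′) (R′≋R″ c c′ c≢c′)

≋-setoid : ℕ → Setoid (lsuc 0ℓ) 0ℓ
≋-setoid n = record
  { Carrier       = Rel (Fin n) 0ℓ
  ; _≈_           = _≋_
  ; isEquivalence = record { refl = λ _ _ _ → ⇔.refl ; sym = ≋-sym ; trans = ≋-trans }
  }

module ≋-Reasoning {n} = SetoidReasoning (≋-setoid n)

AfterRound : (Fin m → Bool) → (Fin n → Fin m) → Rel (Fin n) 0ℓ → Rel (Fin n) 0ℓ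
AfterRound β p _≺_ c c′ = Lex (β (p c)) (p c) (p c′) (c ≺ c′) (c′ ≺ c)

AfterRound-cong-≗ : ∀ {β β′ : Fin m → Bool} {p p′ : Fin n → Fin m} L → β ≗ β′ → p ≗ p′ →
                    ∀ c c′ → AfterRound β p L c c′ ⇔ AfterRound β′ p′ L c c′
AfterRound-cong-≗ {β′ = β′} L β≗β′ p≗p′ c c′ =
  Lex-cong-≡ (trans (β≗β′ _) (cong β′ (p≗p′ c))) (p≗p′ c) (p≗p′ c′)

AfterRound-cong-≋ : ∀ (β : Fin m → Bool) (p : Fin n → Fin m) {L L′} →
                    L ≋ L′ → AfterRound β p L ≋ AfterRound β p L′
AfterRound-cong-≋ β p L≋L′ c c′ c≢c′ = Lex-cong (L≋L′ c c′ c≢c′) (L≋L′ c′ c (c≢c′ ∘ sym))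

AfterRound-trans : ∀ (β : Fin m → Bool) (p : Fin n → Fin m) L →
                   Transitive L → Transitive (AfterRound β p L)
AfterRound-trans β p L L-trans = Lex-trans β L-trans L-trans

AfterRound-asym : ∀ (β : Fin m → Bool) (p : Fin n → Fin m) L →
                  Asymmetric L → Asymmetric (AfterRound β p L)
AfterRound-asym β p L L-asym = Lex-asym β L-asym

AfterRound-onePile : ∀ (p : Fin n → Fin 1) L c c′ → AfterRound (λ _ → false) p L c c′ ⇔ L c c′
AfterRound-onePile p L c c′ with p c | p c′
... | zero | zero = mk⇔ (λ { (inj₁ ()) ; (inj₂ (_ , x)) → x }) (λ x → inj₂ (refl , x))

pileOrder⇔Lex : ∀ t {i j : Fin m} →
                (i < j ⊎ (i ≡ j × t ≡ q × A) ⊎ (i ≡ j × t ≡ s × B)) ⇔ Lex (χ t) i j A B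
pileOrder⇔Lex q = mk⇔
  (λ { (inj₁ i<j) → inj₁ i<j ; (inj₂ (inj₁ (e , _ , x))) → inj₂ (e , x) ; (inj₂ (inj₂ (_ , () , _))) })
  (λ { (inj₁ i<j) → inj₁ i<j ; (inj₂ (e , x)) → inj₂ (inj₁ (e , refl , x)) })
pileOrder⇔Lex s = mk⇔
  (λ { (inj₁ i<j) → inj₁ i<j ; (inj₂ (inj₁ (_ , () , _))) ; (inj₂ (inj₂ (e , _ , x))) → inj₂ (e , x) })
  (λ { (inj₁ i<j) → inj₁ i<j ; (inj₂ (e , x)) → inj₂ (inj₂ (e , refl , x)) })

round⇔ : ∀ (σ : Permutation′ n) (ψ : Vec Ty m) p τ →
         Round σ ψ p τ ⇔ (DeckLt τ ≋ AfterRound (χ ∘ lookup ψ) p (DeckLt σ))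
round⇔ σ ψ p τ = mk⇔
  (λ round c c′ c≢c′ → ⇔.trans (round c c′ c≢c′) (pileOrder⇔Lex (lookup ψ (p c))))
  (λ round c c′ c≢c′ → ⇔.trans (round c c′ c≢c′) (⇔.sym (pileOrder⇔Lex (lookup ψ (p c)))))

roundOutput : ∀ (σ : Permutation′ n) (β : Fin m → Bool) p →
              ∃ λ τ → DeckLt τ ≋ AfterRound β p (DeckLt σ)
roundOutput σ β p = τ , λ c c′ _ → ⇔.trans (τ-order c c′) (merge-< β)
  where
  key : _ → ℕ
  key c = toℕ (merge β (p c) (σ ⟨$⟩ʳ c))
  key-inj : Injective _≡_ _≡_ key
  key-inj e = Injection.injective (↔⇒↣ σ) (proj₂ (merge-injective β (Fin.toℕ-injective e)))
  τ       = proj₁ (rank key key-inj)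
  τ-order = proj₂ (rank key key-inj)

sorted⇔ : ∀ (σ : Permutation′ n) → IsSorted σ ⇔ (_<_ ≋ DeckLt σ)
sorted⇔ σ = mk⇔ preserve reflect
  where
  preserve : IsSorted σ → _<_ ≋ DeckLt σ
  preserve sorted c c′ _ rewrite sorted c | sorted c′ = ⇔.refl
  reflect : _<_ ≋ DeckLt σ → IsSorted σ
  reflect same = increasing⇒≗id (σ ⟨$⟩ʳ_) (λ lt → to (same _ _ (Fin.<⇒≢ lt)) lt)

SortsInOneRound : (Fin m → Bool) → Permutation′ n → Set
SortsInOneRound {m} {n} β σ = ∃ λ (p : Fin n → Fin m) → _<_ ≋ AfterRound β p (DeckLt σ)

SortsInOneRound-cong : ∀ {β β′ : Fin m → Bool} → β ≗ β′ → (σ : Permutation′ n) →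
                       SortsInOneRound β σ ⇔ SortsInOneRound β′ σ
SortsInOneRound-cong β≗β′ σ = mk⇔ (map₂ (retype β≗β′)) (map₂ (retype (sym ∘ β≗β′)))
  where
  retype : ∀ {β β′ p} → β ≗ β′ → _<_ ≋ AfterRound β p (DeckLt σ) → _<_ ≋ AfterRound β′ p (DeckLt σ)
  retype β≗β′ sorted c c′ c≢c′ =
    ⇔.trans (sorted c c′ c≢c′) (AfterRound-cong-≗ (DeckLt σ) β≗β′ (λ _ → refl) c c′)

-- Composing rounds

-- The paper's ψ \ ψ′ on type bits; `χ̂ ((m , ψ) ∷ X)` unfolds to `(χ ∘ lookup ψ) ∖ χ̂ X`.
_∖_ : (Fin m → Bool) → (Fin K → Bool) → Fin (K * m) → Bool
(β ∖ β′) j = β (proj₂ (unmerge β′ j)) xor β′ (proj₁ (unmerge β′ j))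

∖-merge : ∀ (β : Fin m → Bool) (β′ : Fin K → Bool) i r →
          (β ∖ β′) (merge β′ i r) ≡ β r xor β′ i
∖-merge β β′ i r = cong (λ (i , r) → β r xor β′ i) (unmerge-merge β′ i r)

Oriented-Lex : ∀ b (β : Fin m → Bool) {r r′} →
  Oriented b (Lex (β r) r r′ A B) (Lex (β r′) r′ r B A) ⇔
  (Oriented b (r < r′) (r′ < r) ⊎ (r ≡ r′ × Oriented (β r xor b) A B))
Oriented-Lex false β {r} rewrite xor-identityʳ (β r) = ⇔.refl
Oriented-Lex true  β {r} = ⇔.refl ⊎-⇔ mk⇔ preserve reflect
  where
  preserve : ∀ {r′} → r′ ≡ r × Oriented (β r′) _ _ → r ≡ r′ × Oriented (β r xor true) _ _
  preserve (refl , o) with β r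
  ... | false = refl , o
  ... | true  = refl , o
  reflect : ∀ {r′} → r ≡ r′ × Oriented (β r xor true) _ _ → r′ ≡ r × Oriented (β r′) _ _
  reflect (refl , o) with β r
  ... | false = refl , o
  ... | true  = refl , o

Lex-merge : ∀ (β : Fin m → Bool) (β′ : Fin K → Bool) {i i′ r r′} →
  Lex (β′ i) i i′ (Lex (β r) r r′ A B) (Lex (β r′) r′ r B A) ⇔
  Lex (β r xor β′ i) (merge β′ i r) (merge β′ i′ r′) A B
Lex-merge β β′ {i} {i′} {r} {r′} = mk⇔ preserve reflect
  where
  preserve : Lex (β′ i) i i′ _ _ → Lex (β r xor β′ i) (merge β′ i r) (merge β′ i′ r′) _ _
  preserve (inj₁ i<i′) = inj₁ (from (merge-< β′) (inj₁ i<i′))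
  preserve (inj₂ (refl , o)) with to (Oriented-Lex (β′ i) β) o
  ... | inj₁ r≺r′       = inj₁ (from (merge-< β′) (inj₂ (refl , r≺r′)))
  ... | inj₂ (refl , x) = inj₂ (refl , x)
  reflect : Lex (β r xor β′ i) (merge β′ i r) (merge β′ i′ r′) _ _ → Lex (β′ i) i i′ _ _
  reflect (inj₁ lt) with to (merge-< β′) lt
  ... | inj₁ i<i′          = inj₁ i<i′
  ... | inj₂ (refl , r≺r′) = inj₂ (refl , from (Oriented-Lex (β′ i) β) (inj₁ r≺r′))
  reflect (inj₂ (e , x)) with merge-injective β′ e
  ... | refl , refl = inj₂ (refl , from (Oriented-Lex (β′ i) β) (inj₂ (refl , x)))

AfterRound-∘ : ∀ (β : Fin m → Bool) (β′ : Fin K → Bool) p p′ (L : Rel (Fin n) 0ℓ) c c′ →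
               AfterRound β′ p′ (AfterRound β p L) c c′ ⇔
               AfterRound (β ∖ β′) (λ c → merge β′ (p′ c) (p c)) L c c′
AfterRound-∘ β β′ p p′ L c c′ =
  ⇔.trans (Lex-merge β β′) (Lex-cong-≡ (sym (∖-merge β β′ (p′ c) (p c))) refl refl)

sorts⇔oneRound : ∀ (X : Schedule) (σ : Permutation′ n) → Sorts X σ ⇔ SortsInOneRound (χ̂ X) σ
sorts⇔oneRound [] σ = mk⇔
  (λ { (done sorted) → (λ _ → zero) , ≋-trans (to (sorted⇔ σ) sorted) (onePile _) })
  (λ (p , sorted) → done (from (sorted⇔ σ) (≋-trans sorted (≋-sym (onePile p)))))
  where
  onePile : ∀ p → DeckLt σ ≋ AfterRound (λ _ → false) p (DeckLt σ)
  onePile p c c′ _ = ⇔.sym (AfterRound-onePile p (DeckLt σ) c c′)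
sorts⇔oneRound ((m , ψ) ∷ X) σ = mk⇔ compose decompose
  where
  open ≋-Reasoning
  β = χ ∘ lookup ψ

  merged : (Fin n → Fin m) → (Fin n → Fin (M X)) → Fin n → Fin (M X * m)
  merged p p′ c = merge (χ̂ X) (p′ c) (p c)

  twoRounds : ∀ p p′ → AfterRound (χ̂ X) p′ (AfterRound β p (DeckLt σ)) ≋
                       AfterRound (β ∖ χ̂ X) (merged p p′) (DeckLt σ)
  twoRounds p p′ c c′ _ = AfterRound-∘ β (χ̂ X) p p′ (DeckLt σ) c c′

  compose : Sorts ((m , ψ) ∷ X) σ → SortsInOneRound (χ̂ ((m , ψ) ∷ X)) σ
  compose (step p τ round rest) with to (sorts⇔oneRound X τ) rest
  ... | p′ , sorted = merged p p′ , (begin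
    _<_                                              ≈⟨ sorted ⟩
    AfterRound (χ̂ X) p′ (DeckLt τ)                   ≈⟨ AfterRound-cong-≋ (χ̂ X) p′ round′ ⟩
    AfterRound (χ̂ X) p′ (AfterRound β p (DeckLt σ))  ≈⟨ twoRounds p p′ ⟩
    AfterRound (β ∖ χ̂ X) (merged p p′) (DeckLt σ)    ∎)
    where round′ = to (round⇔ σ ψ p τ) round

  decompose : SortsInOneRound (χ̂ ((m , ψ) ∷ X)) σ → Sorts ((m , ψ) ∷ X) σ
  decompose (P , sorted) =
    step p τ (from (round⇔ σ ψ p τ) τ-order) (from (sorts⇔oneRound X τ) (p′ , sorted′))
    where
    p′ = proj₁ ∘ unmerge (χ̂ X) ∘ P
    p  = proj₂ ∘ unmerge (χ̂ X) ∘ P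
    τ       = proj₁ (roundOutput σ β p)
    τ-order = proj₂ (roundOutput σ β p)
    P-merged : AfterRound (β ∖ χ̂ X) P (DeckLt σ) ≋ AfterRound (β ∖ χ̂ X) (merged p p′) (DeckLt σ)
    P-merged c c′ _ =
      AfterRound-cong-≗ {β = β ∖ χ̂ X} (DeckLt σ) (λ _ → refl) (sym ∘ merge-unmerge (χ̂ X) ∘ P) c c′
    sorted′ : _<_ ≋ AfterRound (χ̂ X) p′ (DeckLt τ)
    sorted′ = begin
      _<_                                              ≈⟨ sorted ⟩
      AfterRound (β ∖ χ̂ X) P (DeckLt σ)                ≈⟨ P-merged ⟩
      AfterRound (β ∖ χ̂ X) (merged p p′) (DeckLt σ)    ≈⟨ twoRounds p p′ ⟨
      AfterRound (χ̂ X) p′ (AfterRound β p (DeckLt σ))  ≈⟨ AfterRound-cong-≋ (χ̂ X) p′ (≋-sym τ-order) ⟩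
      AfterRound (χ̂ X) p′ (DeckLt τ)                   ∎

-- One round and the chain automaton

SortsAdjacent : (Fin m → Bool) → Permutation′ (suc k) → (Fin (suc k) → Fin m) → Set
SortsAdjacent β σ p = ∀ i → AfterRound β p (DeckLt σ) (inject₁ i) (suc i)

oneRound⇔adjacent : ∀ (β : Fin m → Bool) (σ : Permutation′ (suc k)) →
                    SortsInOneRound β σ ⇔ ∃ (SortsAdjacent β σ)
oneRound⇔adjacent β σ = mk⇔
  (map₂ λ sorted i → to (sorted _ _ (Fin.<⇒≢ (inject₁<suc i))) (inject₁<suc i))
  (λ (p , adjacent) → p , sortedBy p adjacent)
  where
  sortedBy : ∀ p → SortsAdjacent β σ p → _<_ ≋ AfterRound β p (DeckLt σ)
  sortedBy p adjacent c c′ c≢c′ = mk⇔ (adjacent⇒< R-trans adjacent) reflect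
    where
    R-trans = AfterRound-trans β p (DeckLt σ) Fin.<-trans
    R-asym  = AfterRound-asym β p (DeckLt σ) Fin.<-asym
    reflect : AfterRound β p (DeckLt σ) c c′ → c < c′
    reflect r with Fin.<-cmp c c′
    ... | tri< c<c′ _ _ = c<c′
    ... | tri≈ _ c≡c′ _ = contradiction c≡c′ c≢c′
    ... | tri> _ _ c′<c = ⊥-elim (R-asym (adjacent⇒< R-trans adjacent c′<c) r)

bump-≤1 : ∀ t ℓ → bump t ℓ ≤ 1
bump-≤1 q a = z≤n
bump-≤1 q d = ℕ.≤-refl
bump-≤1 s a = ℕ.≤-refl
bump-≤1 s d = z≤n

Oriented⇔bump≡0 : ∀ {x y : Fin n} → x ≢ y → ∀ t →
                  Oriented (χ t) (x < y) (y < x) ⇔ (bump t (changeLetter x y) ≡ 0)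
Oriented⇔bump≡0 {x = x} {y} x≢y t with toℕ x ℕ.<? toℕ y | t
... | yes x<y | q = mk⇔ (λ _ → refl) (λ _ → x<y)
... | no  x≮y | q = mk⇔ (λ x<y → contradiction x<y x≮y) (λ ())
... | yes x<y | s = mk⇔ (λ y<x → contradiction y<x (Fin.<-asym x<y)) (λ ())
... | no  x≮y | s = mk⇔ (λ _ → refl) (λ _ → ℕ.≤∧≢⇒< (ℕ.≮⇒≥ x≮y) (x≢y ∘ sym ∘ Fin.toℕ-injective))

Lex⇔bump : ∀ {x y : Fin n} → x ≢ y → ∀ t (j j′ : Fin N) →
           Lex (χ t) j j′ (x < y) (y < x) ⇔ toℕ j + bump t (changeLetter x y) ≤ toℕ j′
Lex⇔bump {x = x} {y} x≢y t j j′ = mk⇔ preserve reflect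
  where
  b = bump t (changeLetter x y)
  preserve : Lex (χ t) j j′ (x < y) (y < x) → toℕ j + b ≤ toℕ j′
  preserve (inj₁ j<j′) =
    ℕ.≤-trans (ℕ.+-monoʳ-≤ (toℕ j) (bump-≤1 t _)) (subst (_≤ toℕ j′) (ℕ.+-comm 1 (toℕ j)) j<j′)
  preserve (inj₂ (refl , o)) =
    ℕ.≤-reflexive (trans (cong (toℕ j +_) (to (Oriented⇔bump≡0 x≢y t) o)) (ℕ.+-identityʳ _))
  reflect : toℕ j + b ≤ toℕ j′ → Lex (χ t) j j′ (x < y) (y < x)
  reflect h with ℕ.m≤n⇒m<n∨m≡n (ℕ.m+n≤o⇒m≤o (toℕ j) h)
  ... | inj₁ j<j′ = inj₁ j<j′
  ... | inj₂ j≡j′ with Fin.toℕ-injective j≡j′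
  ... | refl = inj₂ (refl , from (Oriented⇔bump≡0 x≢y t) b≡0)
    where
    b≡0 : b ≡ 0
    b≡0 = ℕ.n≤0⇒n≡0 (ℕ.+-cancelˡ-≤ (toℕ j) _ _ (ℕ.≤-trans h (ℕ.≤-reflexive (sym (ℕ.+-identityʳ _)))))

module _ (ψ : Vec Ty N) where

  chainStep-fin : ∀ (j : Fin N) ℓ → chainStep ψ (toℕ j) ℓ ≡ toℕ j + bump (lookup ψ j) ℓ
  chainStep-fin j ℓ with toℕ j ℕ.<? N
  ... | yes j<N = cong (λ j′ → toℕ j + bump (lookup ψ j′) ℓ) (Fin.fromℕ<-toℕ j j<N)
  ... | no  j≮N = contradiction (Fin.toℕ<n j) j≮N

  chainStep-inflationary : ∀ z ℓ → z ≤ chainStep ψ z ℓ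
  chainStep-inflationary z ℓ with z ℕ.<? N
  ... | yes _ = ℕ.m≤m+n z _
  ... | no  _ = ℕ.≤-refl

  chainStep-≤-suc : ∀ z ℓ → chainStep ψ z ℓ ≤ suc z
  chainStep-≤-suc z ℓ with z ℕ.<? N
  ... | yes z<N = subst (z + bump (lookup ψ (fromℕ< z<N)) ℓ ≤_) (ℕ.+-comm z 1)
                        (ℕ.+-monoʳ-≤ z (bump-≤1 _ ℓ))
  ... | no  _   = ℕ.n≤1+n z

  chainStep-mono : ∀ {z z′} ℓ → z ≤ z′ → chainStep ψ z ℓ ≤ chainStep ψ z′ ℓ
  chainStep-mono {z} {z′} ℓ z≤z′ with ℕ.m≤n⇒m<n∨m≡n z≤z′
  ... | inj₁ z<z′ = ℕ.≤-trans (chainStep-≤-suc z ℓ) (ℕ.≤-trans z<z′ (chainStep-inflationary z′ ℓ))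
  ... | inj₂ refl = ℕ.≤-refl

  foldl-inflationary : ∀ z (w : List Letter) → z ≤ foldl (chainStep ψ) z w
  foldl-inflationary z []      = ℕ.≤-refl
  foldl-inflationary z (ℓ ∷ w) =
    ℕ.≤-trans (chainStep-inflationary z ℓ) (foldl-inflationary _ w)

  Lex⇔chainStep : ∀ {x y : Fin n} → x ≢ y → ∀ (j j′ : Fin N) →
                  Lex (χ (lookup ψ j)) j j′ (x < y) (y < x) ⇔
                  chainStep ψ (toℕ j) (changeLetter x y) ≤ toℕ j′
  Lex⇔chainStep {x = x} {y} x≢y j j′ =
    subst (λ v → Lex (χ (lookup ψ j)) j j′ (x < y) (y < x) ⇔ v ≤ toℕ j′)
          (sym (chainStep-fin j (changeLetter x y))) (Lex⇔bump x≢y (lookup ψ j) j j′)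

  Climb : ℕ → (Fin k → Letter) → (Fin (suc k) → Fin N) → Set
  Climb z g P = z ≤ toℕ (P zero) × ∀ i → chainStep ψ (toℕ (P (inject₁ i))) (g i) ≤ toℕ (P (suc i))

  run≤climb : ∀ z (g : Fin k → Letter) P → Climb z g P →
              foldl (chainStep ψ) z (tabulate g) ≤ toℕ (P (fromℕ k))
  run≤climb {zero}  z g P (start , _)     = start
  run≤climb {suc k} z g P (start , climb) =
    run≤climb (chainStep ψ z (g zero)) (g ∘ suc) (P ∘ suc)
              (ℕ.≤-trans (chainStep-mono (g zero) start) (climb zero) , climb ∘ suc)

  run⇒climb : ∀ z (g : Fin k → Letter) → foldl (chainStep ψ) z (tabulate g) ℕ.< N → ∃ (Climb z g)
  run⇒climb {zero}  z g z<N = (λ _ → fromℕ< z<N) , ℕ.≤-reflexive (sym (Fin.toℕ-fromℕ< z<N)) , λ ()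
  run⇒climb {suc k} z g accepted with run⇒climb (chainStep ψ z (g zero)) (g ∘ suc) accepted
  ... | P , start , climb = P′ , ℕ.≤-reflexive (sym (Fin.toℕ-fromℕ< z<N)) , climb′
    where
    z<N : z ℕ.< N
    z<N = ℕ.≤-<-trans (foldl-inflationary z (tabulate g)) accepted
    P′ : Fin (suc (suc k)) → Fin N
    P′ zero    = fromℕ< z<N
    P′ (suc i) = P i
    climb′ : ∀ i → chainStep ψ (toℕ (P′ (inject₁ i))) (g i) ≤ toℕ (P′ (suc i))
    climb′ zero    =
      subst (λ z′ → chainStep ψ z′ (g zero) ≤ toℕ (P zero)) (sym (Fin.toℕ-fromℕ< z<N)) start
    climb′ (suc i) = climb i

  climb⇔accepts : ∀ z (g : Fin k → Letter) → ∃ (Climb z g) ⇔ foldl (chainStep ψ) z (tabulate g) ℕ.< N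
  climb⇔accepts z g =
    mk⇔ (λ (P , climb) → ℕ.≤-<-trans (run≤climb z g P climb) (Fin.toℕ<n _)) (run⇒climb z g)

letters : Permutation′ (suc k) → Fin k → Letter
letters σ i = changeLetter (σ ⟨$⟩ʳ inject₁ i) (σ ⟨$⟩ʳ suc i)

oneRound⇔accepts : ∀ (ψ : Vec Ty N) (σ : Permutation′ (suc k)) →
                   SortsInOneRound (χ ∘ lookup ψ) σ ⇔ Accepts ψ (Δ σ)
oneRound⇔accepts {N} ψ σ = begin
  SortsInOneRound (χ ∘ lookup ψ) σ          ≈⟨ oneRound⇔adjacent (χ ∘ lookup ψ) σ ⟩
  ∃ (SortsAdjacent (χ ∘ lookup ψ) σ)        ≈⟨ mk⇔ (map₂ λ {p} → climb p) (map₂ λ {p} → adjacent p) ⟩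
  ∃ (Climb ψ 0 (letters σ))                 ≈⟨ climb⇔accepts ψ 0 (letters σ) ⟩
  chainRun ψ (tabulate (letters σ)) ℕ.< N   ≡⟨ cong (λ w → chainRun ψ w ℕ.< N) Δ≡letters ⟨
  Accepts ψ (Δ σ)                           ∎
  where
  open ⇔-Reasoning
  Δ≡letters : Δ σ ≡ tabulate (letters σ)
  Δ≡letters = List.map-tabulate id (letters σ)
  distinct : ∀ i → σ ⟨$⟩ʳ inject₁ i ≢ σ ⟨$⟩ʳ suc i
  distinct i = Fin.<⇒≢ (inject₁<suc i) ∘ Injection.injective (↔⇒↣ σ)
  climb : ∀ p → SortsAdjacent (χ ∘ lookup ψ) σ p → Climb ψ 0 (letters σ) p
  climb p adjacent = z≤n , λ i → to (Lex⇔chainStep ψ (distinct i) _ _) (adjacent i)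
  adjacent : ∀ p → Climb ψ 0 (letters σ) p → SortsAdjacent (χ ∘ lookup ψ) σ p
  adjacent p (_ , climb) i = from (Lex⇔chainStep ψ (distinct i) _ _) (climb i)

χ-toTy : ∀ b → χ (toTy b) ≡ b
χ-toTy true  = refl
χ-toTy false = refl

χ-ψ̂ : ∀ (X : Schedule) j → χ (lookup (ψ̂ X) j) ≡ χ̂ X j
χ-ψ̂ X j = trans (cong χ (Vec.lookup∘tabulate (toTy ∘ χ̂ X) j)) (χ-toTy (χ̂ X j))

corollary1 : (n : ℕ) → 1 ≤ n → (σ : Permutation′ n) → (X : Schedule) →
    Sorts X σ ⇔ Accepts (ψ̂ X) (Δ σ)
corollary1 (suc k) _ σ X = begin
  Sorts X σ                             ≈⟨ sorts⇔oneRound X σ ⟩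
  SortsInOneRound (χ̂ X) σ               ≈⟨ SortsInOneRound-cong (sym ∘ χ-ψ̂ X) σ ⟩
  SortsInOneRound (χ ∘ lookup (ψ̂ X)) σ  ≈⟨ oneRound⇔accepts (ψ̂ X) σ ⟩
  Accepts (ψ̂ X) (Δ σ)                   ∎
  where open ⇔-Reasoning
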